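{- If $q\in\{9,10,\dots,15\}$, then $\operatorname{achr}(K_6\square K_q)\ge 2q+6$.
   Context: For a finite simple graph $G$, $\operatorname{achr}(G)$ (the achromatic number) is the maximum number of colours in a proper vertex colouring of $G$ that is complete, i.e. every pair of distinct colours appears on the two ends of some edge. $K_6\square K_q$ is the Cartesian product of the complete graphs $K_6$ and $K_q$ (vertex set $[1,6]\times[1,q]$, two vertices adjacent iff they agree in exactly one coordinate). -}

module Defs where

open import Data.Nat using (ℕ; _≤_; _*_)
open import Data.Fin using (Fin)
open import Data.Fin.Properties using (*↔×)
open import Data.Product using (Σ; ∃; _×_; _,_)
open import Data.Sum using (_⊎_; inj₁; inj₂)
open import Function.Bundles using (_↔_)
open import Relation.Binary.PropositionalEquality using (_≡_; _≢_; refl; sym)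
open import Relation.Nullary using (¬_)

record Graph : Set₁ where
  field
    V      : Set
    size   : ℕ
    finite : Fin size ↔ V
    Adj    : V → V → Set
    adj-sym    : ∀ {u v} → Adj u v → Adj v u
    adj-irrefl : ∀ {u} → ¬ Adj u u
open Graph public

record CompleteColouring (G : Graph) (m : ℕ) : Set where
  field
    col      : V G → Fin m
    proper   : ∀ {u v} → Adj G u v → col u ≢ col v
    surj     : ∀ (a : Fin m) → ∃ λ u → col u ≡ a
    complete : ∀ (a b : Fin m) → a ≢ b →
               ∃ λ u → ∃ λ v → Adj G u v × col u ≡ a × col v ≡ b

-- achr(G) ≥ k : the maximum number of colours of a complete colouring
-- is at least k, i.e. some complete colouring uses m ≥ k colours.
AchrAtLeast : Graph → ℕ → Set
AchrAtLeast G k = Σ ℕ λ m → k ≤ m × CompleteColouring G m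

AdjKK : (p q : ℕ) → Fin p × Fin q → Fin p × Fin q → Set
AdjKK p q (i , j) (i' , j') = (i ≡ i' × j ≢ j') ⊎ (i ≢ i' × j ≡ j')

private
  ne-sym : ∀ {A : Set} {x y : A} → x ≢ y → y ≢ x
  ne-sym ne e = ne (sym e)

  AdjKK-sym : ∀ p q {u v} → AdjKK p q u v → AdjKK p q v u
  AdjKK-sym p q (inj₁ (e , ne)) = inj₁ (sym e , ne-sym ne)
  AdjKK-sym p q (inj₂ (ne , e)) = inj₂ (ne-sym ne , sym e)

  AdjKK-irrefl : ∀ p q {u} → ¬ AdjKK p q u u
  AdjKK-irrefl p q (inj₁ (_ , ne)) = ne refl
  AdjKK-irrefl p q (inj₂ (ne , _)) = ne refl

KK : ℕ → ℕ → Graph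
KK p q = record
  { V = Fin p × Fin q
  ; size = p * q
  ; finite = *↔×
  ; Adj = AdjKK p q
  ; adj-sym = AdjKK-sym p q
  ; adj-irrefl = AdjKK-irrefl p q
  }

-- A vertex colouring of K_p □ K_q is a p × q array of colours. It is proper iff no colour repeats
-- in a row or a column, and two distinct colours are adjacent as soon as they share a row or a
-- column. For each q ∈ [9, 15] an explicit 6 × q array with 2q + 6 colours having these
-- properties is exhibited, and the finitely many conditions are decided by evaluation.
module Submission where

open import Defs
open import Data.Empty using (⊥-elim)
open import Data.Fin using (Fin; toℕ; fromℕ<)
open import Data.Fin.Properties using (all?; any?; toℕ-injective; toℕ-fromℕ<) renaming (_≟_ to _≟ᶠ_)
open import Data.Nat using (ℕ; suc; _≤_; _<_; _+_; _*_)
open import Data.Nat.Properties using (_≟_; _<?_; ≤-refl; <-irrefl; m≤n⇒∃[o]m+o≡n; m+n≤o⇒m≤o)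
open import Data.Product using (∃; _×_; _,_)
open import Data.Sum using (_⊎_; inj₁; inj₂)
open import Data.Vec using (Vec; []; _∷_; lookup)
open import Relation.Binary.PropositionalEquality using (_≡_; _≢_; refl; sym; trans; cong)
open import Relation.Nullary using (Dec; ¬?)
open import Relation.Nullary.Decidable using (True; toWitness; _×-dec_; _⊎-dec_; _→-dec_)

achrAtLeast : ∀ {G m} → CompleteColouring G m → AchrAtLeast G m
achrAtLeast {m = m} c = m , ≤-refl , c

-- Colours are stored as natural numbers so that the checks below compare them with the
-- built-in equality on ℕ; this keeps the evaluation of the larger tables tractable.
module TableColouring {p q : ℕ} (m : ℕ) (T : Vec (Vec ℕ q) p) where

  entry : Fin p → Fin q → ℕ
  entry i j = lookup (lookup T i) j

  Bounded : Set
  Bounded = ∀ i j → entry i j < m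

  RowsInjective : Set
  RowsInjective = ∀ i j j′ → j ≢ j′ → entry i j ≢ entry i j′

  ColumnsInjective : Set
  ColumnsInjective = ∀ j i i′ → i ≢ i′ → entry i j ≢ entry i′ j

  Surjective : Set
  Surjective = ∀ (a : Fin m) → ∃ λ i → ∃ λ j → entry i j ≡ toℕ a

  OnRow : Fin p → ℕ → Set
  OnRow i x = ∃ λ j → entry i j ≡ x

  OnColumn : Fin q → ℕ → Set
  OnColumn j x = ∃ λ i → entry i j ≡ x

  ShareLine : ℕ → ℕ → Set
  ShareLine x y = (∃ λ i → OnRow i x × OnRow i y) ⊎ (∃ λ j → OnColumn j x × OnColumn j y)

  DistinctColoursShareLine : Set
  DistinctColoursShareLine = ∀ (a b : Fin m) → a ≢ b → ShareLine (toℕ a) (toℕ b)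

  IsComplete : Set
  IsComplete = Bounded × RowsInjective × ColumnsInjective × Surjective × DistinctColoursShareLine

  isComplete? : Dec IsComplete
  isComplete? = bounded? ×-dec rowsInjective? ×-dec columnsInjective? ×-dec surjective? ×-dec shareLines?
    where
    bounded? : Dec Bounded
    bounded? = all? λ i → all? λ j → entry i j <? m
    rowsInjective? : Dec RowsInjective
    rowsInjective? = all? λ i → all? λ j → all? λ j′ →
      ¬? (j ≟ᶠ j′) →-dec ¬? (entry i j ≟ entry i j′)
    columnsInjective? : Dec ColumnsInjective
    columnsInjective? = all? λ j → all? λ i → all? λ i′ →
      ¬? (i ≟ᶠ i′) →-dec ¬? (entry i j ≟ entry i′ j)
    surjective? : Dec Surjective
    surjective? = all? λ a → any? λ i → any? λ j → entry i j ≟ toℕ a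
    onRow? : ∀ i x → Dec (OnRow i x)
    onRow? i x = any? λ j → entry i j ≟ x
    onColumn? : ∀ j x → Dec (OnColumn j x)
    onColumn? j x = any? λ i → entry i j ≟ x
    shareLines? : Dec DistinctColoursShareLine
    shareLines? = all? λ a → all? λ b → ¬? (a ≟ᶠ b) →-dec
      ((any? λ i → onRow? i (toℕ a) ×-dec onRow? i (toℕ b))
        ⊎-dec (any? λ j → onColumn? j (toℕ a) ×-dec onColumn? j (toℕ b)))

  module _ (bounded : Bounded) where

    colour : Fin p × Fin q → Fin m
    colour (i , j) = fromℕ< (bounded i j)

    toℕ-colour : ∀ i j → toℕ (colour (i , j)) ≡ entry i j
    toℕ-colour i j = toℕ-fromℕ< (bounded i j)

    colour-≡ : ∀ {i j a} → entry i j ≡ toℕ a → colour (i , j) ≡ a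
    colour-≡ {i} {j} e = toℕ-injective (trans (toℕ-colour i j) e)

    proper : RowsInjective → ColumnsInjective → ∀ {u v} → AdjKK p q u v → colour u ≢ colour v
    proper rows _ {i , j} {.i , j′} (inj₁ (refl , j≢j′)) c≡c′ =
      rows i j j′ j≢j′ (trans (sym (toℕ-colour i j)) (trans (cong toℕ c≡c′) (toℕ-colour i j′)))
    proper _ cols {i , j} {i′ , .j} (inj₂ (i≢i′ , refl)) c≡c′ =
      cols j i i′ i≢i′ (trans (sym (toℕ-colour i j)) (trans (cong toℕ c≡c′) (toℕ-colour i′ j)))

    edgeBetween : ∀ {a b} → a ≢ b → ShareLine (toℕ a) (toℕ b) →
                  ∃ λ u → ∃ λ v → AdjKK p q u v × colour u ≡ a × colour v ≡ b
    edgeBetween a≢b (inj₁ (i , (j , ea) , (j′ , eb))) =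
      (i , j) , (i , j′) , inj₁ (refl , λ { refl → a≢b (toℕ-injective (trans (sym ea) eb)) })
              , colour-≡ ea , colour-≡ eb
    edgeBetween a≢b (inj₂ (j , (i , ea) , (i′ , eb))) =
      (i , j) , (i′ , j) , inj₂ ((λ { refl → a≢b (toℕ-injective (trans (sym ea) eb)) }) , refl)
              , colour-≡ ea , colour-≡ eb

  completeColouring : IsComplete → CompleteColouring (KK p q) m
  completeColouring (bounded , rows , cols , surj , share) = record
    { col      = colour bounded
    ; proper   = proper bounded rows cols
    ; surj     = λ a → let i , j , e = surj a in (i , j) , colour-≡ bounded e
    ; complete = λ a b a≢b → edgeBetween bounded a≢b (share a b a≢b)
    }

fromTable : ∀ {p q} m (T : Vec (Vec ℕ q) p) → True (TableColouring.isComplete? m T) →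
            CompleteColouring (KK p q) m
fromTable m T ok = TableColouring.completeColouring m T (toWitness ok)

table9 : Vec (Vec ℕ 9) 6
table9 =
    (18 ∷ 22 ∷ 5 ∷ 6 ∷ 13 ∷ 2 ∷ 7 ∷ 8 ∷ 20 ∷ [])
  ∷ (22 ∷ 20 ∷ 16 ∷ 4 ∷ 11 ∷ 3 ∷ 9 ∷ 15 ∷ 18 ∷ [])
  ∷ (20 ∷ 18 ∷ 0 ∷ 17 ∷ 12 ∷ 1 ∷ 14 ∷ 10 ∷ 22 ∷ [])
  ∷ (21 ∷ 23 ∷ 6 ∷ 5 ∷ 10 ∷ 9 ∷ 3 ∷ 12 ∷ 19 ∷ [])
  ∷ (23 ∷ 19 ∷ 11 ∷ 14 ∷ 16 ∷ 8 ∷ 17 ∷ 2 ∷ 21 ∷ [])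
  ∷ (19 ∷ 21 ∷ 1 ∷ 15 ∷ 7 ∷ 0 ∷ 13 ∷ 4 ∷ 23 ∷ [])
  ∷ []

table10 : Vec (Vec ℕ 10) 6
table10 =
    (1 ∷ 5 ∷ 16 ∷ 23 ∷ 20 ∷ 22 ∷ 6 ∷ 17 ∷ 24 ∷ 13 ∷ [])
  ∷ (3 ∷ 0 ∷ 9 ∷ 21 ∷ 25 ∷ 18 ∷ 13 ∷ 10 ∷ 19 ∷ 6 ∷ [])
  ∷ (7 ∷ 11 ∷ 17 ∷ 25 ∷ 18 ∷ 19 ∷ 15 ∷ 16 ∷ 21 ∷ 12 ∷ [])
  ∷ (10 ∷ 15 ∷ 14 ∷ 22 ∷ 23 ∷ 24 ∷ 11 ∷ 3 ∷ 20 ∷ 8 ∷ [])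
  ∷ (12 ∷ 9 ∷ 0 ∷ 20 ∷ 24 ∷ 23 ∷ 2 ∷ 4 ∷ 22 ∷ 7 ∷ [])
  ∷ (5 ∷ 1 ∷ 8 ∷ 18 ∷ 19 ∷ 21 ∷ 4 ∷ 2 ∷ 25 ∷ 14 ∷ [])
  ∷ []

table11 : Vec (Vec ℕ 11) 6
table11 =
    (21 ∷ 6 ∷ 2 ∷ 1 ∷ 18 ∷ 25 ∷ 3 ∷ 12 ∷ 22 ∷ 0 ∷ 20 ∷ [])
  ∷ (18 ∷ 10 ∷ 9 ∷ 4 ∷ 25 ∷ 20 ∷ 14 ∷ 8 ∷ 21 ∷ 5 ∷ 22 ∷ [])
  ∷ (26 ∷ 4 ∷ 3 ∷ 10 ∷ 24 ∷ 19 ∷ 2 ∷ 13 ∷ 27 ∷ 15 ∷ 23 ∷ [])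
  ∷ (24 ∷ 7 ∷ 16 ∷ 12 ∷ 19 ∷ 23 ∷ 5 ∷ 1 ∷ 26 ∷ 14 ∷ 27 ∷ [])
  ∷ (25 ∷ 16 ∷ 7 ∷ 17 ∷ 22 ∷ 18 ∷ 11 ∷ 15 ∷ 20 ∷ 13 ∷ 21 ∷ [])
  ∷ (23 ∷ 0 ∷ 8 ∷ 11 ∷ 27 ∷ 26 ∷ 17 ∷ 9 ∷ 19 ∷ 6 ∷ 24 ∷ [])
  ∷ []

table12 : Vec (Vec ℕ 12) 6
table12 =
    (7 ∷ 17 ∷ 21 ∷ 25 ∷ 26 ∷ 29 ∷ 8 ∷ 23 ∷ 16 ∷ 12 ∷ 6 ∷ 28 ∷ [])
  ∷ (10 ∷ 1 ∷ 29 ∷ 21 ∷ 25 ∷ 26 ∷ 14 ∷ 28 ∷ 15 ∷ 5 ∷ 11 ∷ 23 ∷ [])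
  ∷ (17 ∷ 7 ∷ 22 ∷ 20 ∷ 18 ∷ 19 ∷ 15 ∷ 27 ∷ 14 ∷ 9 ∷ 3 ∷ 24 ∷ [])
  ∷ (11 ∷ 4 ∷ 18 ∷ 24 ∷ 19 ∷ 27 ∷ 12 ∷ 20 ∷ 0 ∷ 8 ∷ 10 ∷ 22 ∷ [])
  ∷ (2 ∷ 0 ∷ 26 ∷ 23 ∷ 28 ∷ 21 ∷ 13 ∷ 25 ∷ 4 ∷ 3 ∷ 9 ∷ 29 ∷ [])
  ∷ (13 ∷ 5 ∷ 27 ∷ 18 ∷ 24 ∷ 20 ∷ 2 ∷ 22 ∷ 6 ∷ 1 ∷ 16 ∷ 19 ∷ [])
  ∷ []

table13 : Vec (Vec ℕ 13) 6
table13 =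
    (25 ∷ 19 ∷ 23 ∷ 30 ∷ 24 ∷ 1 ∷ 29 ∷ 20 ∷ 5 ∷ 0 ∷ 7 ∷ 16 ∷ 2 ∷ [])
  ∷ (29 ∷ 20 ∷ 30 ∷ 24 ∷ 19 ∷ 14 ∷ 23 ∷ 25 ∷ 8 ∷ 3 ∷ 4 ∷ 13 ∷ 9 ∷ [])
  ∷ (31 ∷ 27 ∷ 22 ∷ 28 ∷ 18 ∷ 17 ∷ 21 ∷ 26 ∷ 3 ∷ 8 ∷ 15 ∷ 2 ∷ 16 ∷ [])
  ∷ (28 ∷ 22 ∷ 18 ∷ 27 ∷ 21 ∷ 5 ∷ 26 ∷ 31 ∷ 1 ∷ 12 ∷ 13 ∷ 4 ∷ 6 ∷ [])
  ∷ (23 ∷ 25 ∷ 20 ∷ 29 ∷ 30 ∷ 15 ∷ 24 ∷ 19 ∷ 10 ∷ 6 ∷ 17 ∷ 11 ∷ 12 ∷ [])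
  ∷ (18 ∷ 21 ∷ 26 ∷ 22 ∷ 31 ∷ 9 ∷ 27 ∷ 28 ∷ 11 ∷ 7 ∷ 0 ∷ 10 ∷ 14 ∷ [])
  ∷ []

table14 : Vec (Vec ℕ 14) 6
table14 =
    (22 ∷ 31 ∷ 4 ∷ 23 ∷ 21 ∷ 26 ∷ 25 ∷ 6 ∷ 29 ∷ 30 ∷ 5 ∷ 9 ∷ 1 ∷ 8 ∷ [])
  ∷ (23 ∷ 26 ∷ 0 ∷ 22 ∷ 25 ∷ 30 ∷ 21 ∷ 15 ∷ 31 ∷ 29 ∷ 13 ∷ 14 ∷ 10 ∷ 3 ∷ [])
  ∷ (26 ∷ 30 ∷ 12 ∷ 21 ∷ 29 ∷ 22 ∷ 23 ∷ 11 ∷ 25 ∷ 31 ∷ 7 ∷ 17 ∷ 2 ∷ 16 ∷ [])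
  ∷ (28 ∷ 27 ∷ 6 ∷ 18 ∷ 19 ∷ 20 ∷ 24 ∷ 4 ∷ 33 ∷ 32 ∷ 14 ∷ 13 ∷ 16 ∷ 2 ∷ [])
  ∷ (27 ∷ 33 ∷ 7 ∷ 19 ∷ 28 ∷ 18 ∷ 32 ∷ 10 ∷ 20 ∷ 24 ∷ 12 ∷ 8 ∷ 15 ∷ 9 ∷ [])
  ∷ (32 ∷ 19 ∷ 3 ∷ 33 ∷ 27 ∷ 24 ∷ 20 ∷ 17 ∷ 18 ∷ 28 ∷ 1 ∷ 11 ∷ 5 ∷ 0 ∷ [])
  ∷ []

table15 : Vec (Vec ℕ 15) 6
table15 =
    (22 ∷ 15 ∷ 33 ∷ 34 ∷ 30 ∷ 5 ∷ 31 ∷ 11 ∷ 1 ∷ 23 ∷ 19 ∷ 14 ∷ 28 ∷ 26 ∷ 7 ∷ [])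
  ∷ (29 ∷ 12 ∷ 25 ∷ 27 ∷ 21 ∷ 10 ∷ 20 ∷ 16 ∷ 14 ∷ 35 ∷ 18 ∷ 1 ∷ 24 ∷ 32 ∷ 3 ∷ [])
  ∷ (27 ∷ 11 ∷ 20 ∷ 32 ∷ 18 ∷ 0 ∷ 24 ∷ 15 ∷ 9 ∷ 21 ∷ 35 ∷ 4 ∷ 25 ∷ 29 ∷ 13 ∷ [])
  ∷ (33 ∷ 3 ∷ 23 ∷ 30 ∷ 31 ∷ 9 ∷ 22 ∷ 6 ∷ 0 ∷ 34 ∷ 26 ∷ 17 ∷ 19 ∷ 28 ∷ 12 ∷ [])
  ∷ (32 ∷ 2 ∷ 24 ∷ 29 ∷ 35 ∷ 7 ∷ 25 ∷ 17 ∷ 8 ∷ 18 ∷ 21 ∷ 6 ∷ 20 ∷ 27 ∷ 5 ∷ [])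
  ∷ (31 ∷ 8 ∷ 34 ∷ 19 ∷ 28 ∷ 16 ∷ 26 ∷ 10 ∷ 2 ∷ 22 ∷ 33 ∷ 13 ∷ 30 ∷ 23 ∷ 4 ∷ [])
  ∷ []

proposition6 : (q : ℕ) → 9 ≤ q → q ≤ 15 → AchrAtLeast (KK 6 q) (2 * q + 6)
proposition6 q 9≤q q≤15 with m≤n⇒∃[o]m+o≡n 9≤q
... | 0 , refl = achrAtLeast (fromTable 24 table9 _)
... | 1 , refl = achrAtLeast (fromTable 26 table10 _)
... | 2 , refl = achrAtLeast (fromTable 28 table11 _)
... | 3 , refl = achrAtLeast (fromTable 30 table12 _)
... | 4 , refl = achrAtLeast (fromTable 32 table13 _)
... | 5 , refl = achrAtLeast (fromTable 34 table14 _)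
... | 6 , refl = achrAtLeast (fromTable 36 table15 _)
... | suc (suc (suc (suc (suc (suc (suc k)))))) , refl = ⊥-elim (<-irrefl refl (m+n≤o⇒m≤o 16 q≤15))
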